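{- Let $\theta\in(0,1)$ be irrational with continued fraction $[0;a_1,a_2,\dots]$, let $k\ge1$ be even, $\ell\ge1$, and let $\tilde r_{k+1}$ be defined by $r_{k+1}=\lfloor\sqrt{4a_{k+1}+5}\rfloor-3$ if $a_{k+1}\ne2$, $r_{k+1}=1$ if $a_{k+1}=2$, and $\tilde r_{k+1}=2$ if $a_{k+1}=4$ and $a_{k+2}\ge2$, $\tilde r_{k+1}=r_{k+1}$ otherwise. Let $(u_j)$ be the Fibonacci sequence $u_0=0$, $u_1=1$, $u_{j+1}=u_j+u_{j-1}$. (a) If $a_{k+j}=1$ for $2\le j\le\ell$, then for each $1\le i\le q_k$, $$\#\left\{1\le j\le q_{k+\ell}: j\theta\in\left(i\theta-\|q_k\theta\|,\ i\theta+\tilde r_{k+1}\|q_k\theta\|+\|q_{k+1}\theta\|\right)\right\}\ge u_\ell\tilde r_{k+1}+u_{\ell+1}.$$ (b) If $a_{k+2}=2$ and $a_{k+j}=1$ for $3\le j\le\ell$, then for each $1\le i\le q_k$, $$\#\left\{1\le j\le q_{k+\ell}: j\theta\in\left(i\theta-\|q_{k+1}\theta\|-\|q_{k+2}\theta\|,\ i\theta+\tilde r_{k+1}\|q_k\theta\|+\|q_{k+1}\theta\|\right)\right\}\ge u_{\ell+1}(\tilde r_{k+1}+1).$$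
   Context: $\|t\|$ is the distance from $t$ to the nearest integer; $\mathbb T=\mathbb R/\mathbb Z$, points $j\theta$ are viewed in $\mathbb T$, and an interval $(x-a,x+b)$ with $x\in\mathbb T$ denotes the image in $\mathbb T$ of the corresponding real interval. $q_k$ are the denominators of the convergents of $\theta$, with $q_0=1$ and $q_{n+1}=a_{n+1}q_n+q_{n-1}$. -}

module Defs where

open import Data.Nat as ℕ using (ℕ; zero; suc; _≤ᵇ_)
open import Data.Integer as ℤ using (ℤ; +_; _+_; _*_; -_; _-_; _<_; _≤_)
open import Data.Product using (Σ; _×_; _,_; proj₁; proj₂; ∃-syntax)
open import Data.Sum using (_⊎_)
open import Data.Bool using (if_then_else_)
open import Relation.Binary.PropositionalEquality using (_≡_)
open import Relation.Nullary using (¬_)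

-- The irrational θ ∈ (0,1) is given by its continued fraction
-- [0; a 1, a 2, …]; a 0 is ignored (the integer part is 0) and the
-- partial quotients a (suc n) are assumed ≥ 1 in the statement.

CF : Set
CF = ℕ → ℕ

qq : CF → ℕ → ℕ × ℕ
qq a zero = 0 , 1
qq a (suc n) = proj₂ (qq a n) , (a (suc n) ℕ.* proj₂ (qq a n) ℕ.+ proj₁ (qq a n))

pp : CF → ℕ → ℕ × ℕ
pp a zero = 1 , 0
pp a (suc n) = proj₂ (pp a n) , (a (suc n) ℕ.* proj₂ (pp a n) ℕ.+ proj₁ (pp a n))

q : CF → ℕ → ℕ
q a n = proj₂ (qq a n)

p : CF → ℕ → ℕ
p a n = proj₂ (pp a n)

-- Real numbers of the form A θ + B with A, B ∈ ℤ ("θ-forms").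
-- Since θ is irrational, (A , B) is uniquely determined by the real.

Form : Set
Form = ℤ × ℤ

infixl 6 _⊕_ _⊖_
_⊕_ : Form → Form → Form
(A , B) ⊕ (C , D) = (A + C) , (B + D)

⊝_ : Form → Form
⊝ (A , B) = (- A) , (- B)

_⊖_ : Form → Form → Form
x ⊖ y = x ⊕ (⊝ y)

_·_ : ℕ → Form → Form
n · (A , B) = (+ n * A) , (+ n * B)

θ-mul : ℕ → ℤ → Form
θ-mul j m = + j , m

cst : ℤ → Form
cst m = + 0 , m

-- A θ + B > 0, where θ = lim p_n / q_n.  Since A θ + B = lim (A p_n + B q_n)/q_n
-- and q_n > 0, the real A θ + B is > 0 iff A p_n + B q_n is eventually > 0
-- (it is then bounded away from 0; if A θ + B ≤ 0 this never happens
-- eventually, since A θ + B < 0 or A = B = 0).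
Pos : CF → Form → Set
Pos a (A , B) = ∃[ N ] (∀ n → N ℕ.≤ n → + 0 < A * + p a n + B * + q a n)

_<[_]_ : Form → CF → Form → Set
x <[ a ] y = Pos a (y ⊖ x)

_≤[_]_ : Form → CF → Form → Set
x ≤[ a ] y = ¬ (y <[ a ] x)

-- d represents the real ‖ n θ ‖, the distance from n θ to the nearest integer:
-- d = | n θ - c | for some integer c with | n θ - c | ≤ 1/2.
IsDistWith : CF → ℕ → Form → ℤ → Set
IsDistWith a n d c =
  ( ((d ≡ y) × (cst (+ 0) ≤[ a ] y)) ⊎ ((d ≡ ⊝ y) × (y ≤[ a ] cst (+ 0))) )
  × ((2 · d) ≤[ a ] cst (+ 1))
  where
  y : Form
  y = θ-mul n (- c)

IsDist : CF → ℕ → Form → Set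
IsDist a n d = ∃[ c ] IsDistWith a n d c

-- Points of the circle 𝕋 = ℝ/ℤ.
-- j θ ∈ (lo , hi) in 𝕋 (image of the real open interval (lo , hi)):
-- some real representative j θ + m of the point j θ lies in (lo , hi).

InArc : CF → ℕ → Form → Form → Set
InArc a j lo hi = ∃[ m ] ((lo <[ a ] θ-mul j m) × (θ-mul j m <[ a ] hi))

-- Counting: # { 1 ≤ j ≤ Q : P j } ≥ N  means there are N distinct such j.

open import Data.Fin using (Fin)

AtLeast : ℕ → ℕ → (ℕ → Set) → Set
AtLeast N Q P =
  Σ (Fin N → ℕ) λ f → ( (∀ {s t : Fin N} → f s ≡ f t → s ≡ t)
         × (∀ (t : Fin N) → (1 ℕ.≤ f t) × (f t ℕ.≤ Q) × P (f t)) )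

isqrt : ℕ → ℕ
isqrt zero = zero
isqrt (suc n) with isqrt n
... | s = if (suc s ℕ.* suc s) ≤ᵇ suc n then suc s else s

fib : ℕ → ℕ
fib zero = 0
fib (suc zero) = 1
fib (suc (suc n)) = fib (suc n) ℕ.+ fib n

-- r(x) = ⌊√(4x+5)⌋ - 3 if x ≠ 2, and 1 if x = 2
-- (for x ≥ 1, ⌊√(4x+5)⌋ ≥ 3 so truncated subtraction is exact)
r : ℕ → ℕ
r 2 = 1
r x = isqrt (4 ℕ.* x ℕ.+ 5) ℕ.∸ 3

-- r̃(x , y) = 2 if x = 4 and y ≥ 2, r(x) otherwise;
-- r̃_{k+1} = r̃ (a_{k+1}) (a_{k+2})
r̃ : ℕ → ℕ → ℕ
r̃ 4 (suc (suc _)) = 2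
r̃ x _ = r x

{-# OPTIONS --safe #-}
module Submission where

-- A real A θ + B is handled through the integers A p_n + B q_n (see Pos), whose eventual sign is
-- the sign of A θ + B.  For m ≥ 1 the nearest integer to q_m θ is p_m, since the identity
-- q_{m+1} ‖q_m θ‖ + q_m ‖q_{m+1} θ‖ = 1 forces ‖q_m θ‖ < 1/2; hence ‖q_m θ‖ = (-1)^m (q_m θ - p_m),
-- and the arcs of the statement become explicit combinations of these numbers.
--
-- The counted points j θ + c are produced level by level.  At level n, a point with 1 ≤ j ≤ q_n is
-- well placed when, seen in the direction of q_n θ - p_n, it is at least ‖q_n θ‖ away from the end
-- of the arc behind it and at least ‖q_{n+1} θ‖ away from the end ahead of it.  If a_{n+2} = 1, the
-- well-placed points of level n+1 stay well placed at level n+2, and so do those of level n once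
-- moved by q_{n+1}, i.e. by ‖q_{n+1} θ‖ = ‖q_n θ‖ - ‖q_{n+2} θ‖ backwards; the two sets are disjoint
-- because their indices lie in [1, q_{n+1}] and (q_{n+1}, q_{n+2}].  So the counts satisfy the
-- Fibonacci recurrence.  They start from the points i + m q_k (0 ≤ m ≤ r̃_{k+1}), which are
-- ‖q_k θ‖ apart and fit below q_{k+1} because r̃_{k+1} < a_{k+1}; in (b), a_{k+2} = 2 lets the same
-- points be used a second time, moved by q_{k+1}.

open import Defs

open import Data.Nat as ℕ using (ℕ; zero; suc; _≤_; _<_; z≤n; s≤s)
import Data.Nat.Properties as ℕP
open import Data.Nat.Divisibility using (_∣_; divides)
open import Data.Integer as ℤ using (ℤ; +_; -_; +[1+_]; -[1+_]; 0ℤ; 1ℤ; -1ℤ)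
import Data.Integer.Properties as ℤP
open import Data.Integer.Tactic.RingSolver using (solve-∀)
import Data.Nat.Tactic.RingSolver as ℕ-Solver
open import Data.Fin as Fin using (Fin; splitAt; _↑ˡ_; _↑ʳ_; toℕ)
open import Data.Fin.Properties using (splitAt⁻¹-↑ˡ; splitAt⁻¹-↑ʳ; toℕ-injective; toℕ<n)
open import Data.Product using (_×_; _,_; proj₁; proj₂; ∃-syntax)
open import Data.Sum using (_⊎_; inj₁; inj₂; [_,_]′)
open import Data.Empty using (⊥-elim)
open import Data.Bool using (true; false; T)
open import Data.Unit using (tt)
open import Function using (_∘_; id)
open import Function.Definitions using (Injective)
open import Relation.Nullary using (¬_)
open import Relation.Binary.PropositionalEquality

sgn : ℕ → ℤ
sgn zero = 1ℤ
sgn (suc n) = - sgn n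

sgn*sgn : ∀ n → sgn n ℤ.* sgn n ≡ 1ℤ
sgn*sgn zero = refl
sgn*sgn (suc n) = trans (neg*neg (sgn n)) (sgn*sgn n)
  where
  neg*neg : ∀ s → (- s) ℤ.* (- s) ≡ s ℤ.* s
  neg*neg = solve-∀

sgn≡±1 : ∀ n → sgn n ≡ 1ℤ ⊎ sgn n ≡ -1ℤ
sgn≡±1 zero = inj₁ refl
sgn≡±1 (suc n) with sgn≡±1 n
... | inj₁ s≡1 = inj₂ (cong -_ s≡1)
... | inj₂ s≡-1 = inj₁ (cong -_ s≡-1)

sgn-even : ∀ {n} → 2 ∣ n → sgn n ≡ 1ℤ
sgn-even (divides h refl) = even h
  where
  even : ∀ h → sgn (h ℕ.* 2) ≡ 1ℤ
  even zero = refl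
  even (suc h) = trans (ℤP.neg-involutive (sgn (h ℕ.* 2))) (even h)

0≤+ : ∀ n → 0ℤ ℤ.≤ + n
0≤+ n = ℤ.+≤+ z≤n

*-nonneg : ∀ {x y} → 0ℤ ℤ.≤ x → 0ℤ ℤ.≤ y → 0ℤ ℤ.≤ x ℤ.* y
*-nonneg (ℤ.+≤+ {n = x} _) (ℤ.+≤+ {n = y} _) = subst (0ℤ ℤ.≤_) (ℤP.pos-* x y) (ℤ.+≤+ z≤n)

*-pos : ∀ {x y} → 0ℤ ℤ.< x → 0ℤ ℤ.< y → 0ℤ ℤ.< x ℤ.* y
*-pos (ℤ.+<+ {n = suc x} _) (ℤ.+<+ {n = suc y} _) = ℤ.+<+ (s≤s z≤n)

x≤y+x : ∀ {x y} → 0ℤ ℤ.≤ y → x ℤ.≤ y ℤ.+ x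
x≤y+x {x} {y} y≥0 = ℤP.i≤j+i x y {{ℤ.nonNegative y≥0}}

x≤x+y : ∀ {x y} → 0ℤ ℤ.≤ y → x ℤ.≤ x ℤ.+ y
x≤x+y {x} {y} y≥0 = ℤP.i≤i+j x y {{ℤ.nonNegative y≥0}}

pos+nonneg+nonneg : ∀ {x y w} → 0ℤ ℤ.< x → 0ℤ ℤ.≤ y → 0ℤ ℤ.≤ w → 0ℤ ℤ.< x ℤ.+ y ℤ.+ w
pos+nonneg+nonneg x>0 y≥0 w≥0 = ℤP.+-mono-<-≤ (ℤP.+-mono-<-≤ x>0 y≥0) w≥0

sign-bounds : ∀ {σ g} → σ ≡ 1ℤ ⊎ σ ≡ -1ℤ → 0ℤ ℤ.≤ g →
  0ℤ ℤ.≤ g ℤ.+ σ ℤ.* g × 0ℤ ℤ.≤ g ℤ.- σ ℤ.* g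
sign-bounds {g = g} (inj₁ refl) g≥0 =
  subst (0ℤ ℤ.≤_) (sym (double g)) (ℤP.+-mono-≤ g≥0 g≥0) , ℤP.≤-reflexive (sym (cancel g))
  where
  double : ∀ g → g ℤ.+ 1ℤ ℤ.* g ≡ g ℤ.+ g
  double = solve-∀
  cancel : ∀ g → g ℤ.- 1ℤ ℤ.* g ≡ 0ℤ
  cancel = solve-∀
sign-bounds {g = g} (inj₂ refl) g≥0 =
  ℤP.≤-reflexive (sym (cancel g)) , subst (0ℤ ℤ.≤_) (sym (double g)) (ℤP.+-mono-≤ g≥0 g≥0)
  where
  double : ∀ g → g ℤ.- -1ℤ ℤ.* g ≡ g ℤ.+ g
  double = solve-∀
  cancel : ∀ g → g ℤ.+ -1ℤ ℤ.* g ≡ 0ℤ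
  cancel = solve-∀

Eventually : (ℕ → Set) → Set
Eventually P = ∃[ N ] (∀ n → N ≤ n → P n)

eventually-map : ∀ {P R : ℕ → Set} → (∀ {n} → P n → R n) → Eventually P → Eventually R
eventually-map f (N , p) = N , λ n N≤n → f (p n N≤n)

infixr 2 _∧ᵉ_
_∧ᵉ_ : ∀ {P R : ℕ → Set} → Eventually P → Eventually R → Eventually (λ n → P n × R n)
(M , p) ∧ᵉ (N , r) =
  M ℕ.⊔ N , λ n le → p n (ℕP.≤-trans (ℕP.m≤m⊔n M N) le) , r n (ℕP.≤-trans (ℕP.m≤n⊔m M N) le)

infix 4 _≥ᵉ_ _≡ᵉ_

_≥ᵉ_ : (ℕ → ℤ) → (ℕ → ℤ) → Set
f ≥ᵉ g = Eventually (λ n → g n ℤ.≤ f n)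

_≡ᵉ_ : (ℕ → ℤ) → (ℕ → ℤ) → Set
f ≡ᵉ g = Eventually (λ n → f n ≡ g n)

≡ᵉ⇒≥ᵉ : ∀ {f g} → f ≡ᵉ g → f ≥ᵉ g
≡ᵉ⇒≥ᵉ = eventually-map (λ f≡g → ℤP.≤-reflexive (sym f≡g))

≥ᵉ-trans : ∀ {f g h} → f ≥ᵉ g → g ≥ᵉ h → f ≥ᵉ h
≥ᵉ-trans f≥g g≥h = eventually-map (λ (g≤f , h≤g) → ℤP.≤-trans h≤g g≤f) (f≥g ∧ᵉ g≥h)

Point : Set
Point = ℕ × ℤ

form : Point → Form
form (j , c) = θ-mul j c

infixl 6 _+ₚ_
_+ₚ_ : Point → Point → Point
(j , c) +ₚ (j' , c') = j ℕ.+ j' , c ℤ.+ c'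

record Family (Good : Point → Set) (N : ℕ) : Set where
  field
    point : Fin N → Point
    distinct : Injective _≡_ _≡_ (proj₁ ∘ point)
    good : ∀ t → Good (point t)
open Family

family-singleton : ∀ {G u} → G u → Family G 1
family-singleton {u = u} good-u = record
  { point = λ _ → u ; distinct = λ { {Fin.zero} {Fin.zero} _ → refl } ; good = λ _ → good-u }

family-map : ∀ {G G' N} (h : Point → Point) → (∀ {u v} → proj₁ (h u) ≡ proj₁ (h v) → proj₁ u ≡ proj₁ v) →
  (∀ {u} → G u → G' (h u)) → Family G N → Family G' N
family-map h h-inj h-good F = record
  { point = h ∘ point F ; distinct = distinct F ∘ h-inj ; good = h-good ∘ good F }

family-++ : ∀ {G M N} (F : Family G M) (F' : Family G N) →
  (∀ s t → proj₁ (point F s) ≢ proj₁ (point F' t)) → Family G (M ℕ.+ N)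
family-++ {G} {M} {N} F F' disjoint = record { point = joined ; distinct = λ {s} {t} → injective s t ; good = joined-good }
  where
  joined : Fin (M ℕ.+ N) → Point
  joined s = [ point F , point F' ]′ (splitAt M s)
  joined-good : ∀ s → G (joined s)
  joined-good s with splitAt M s
  ... | inj₁ s' = good F s'
  ... | inj₂ s' = good F' s'
  injective : ∀ s t → proj₁ (joined s) ≡ proj₁ (joined t) → s ≡ t
  injective s t eq with splitAt M s in es | splitAt M t in et
  ... | inj₁ s' | inj₁ t' = trans (sym (splitAt⁻¹-↑ˡ es)) (trans (cong (_↑ˡ N) (distinct F eq)) (splitAt⁻¹-↑ˡ et))
  ... | inj₁ s' | inj₂ t' = ⊥-elim (disjoint s' t' eq)
  ... | inj₂ s' | inj₁ t' = ⊥-elim (disjoint t' s' (sym eq))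
  ... | inj₂ s' | inj₂ t' = trans (sym (splitAt⁻¹-↑ʳ es)) (trans (cong (M ↑ʳ_) (distinct F' eq)) (splitAt⁻¹-↑ʳ et))

module Convergents (a : CF) where

  open import Data.Integer using (_+_; _*_; _-_)

  P Q : ℕ → ℤ
  P n = + p a n
  Q n = + q a n

  ev : Form → ℕ → ℤ
  ev (A , B) n = A * P n + B * Q n

  ev-⊕ : ∀ F G n → ev (F ⊕ G) n ≡ ev F n + ev G n
  ev-⊕ (A , B) (C , D) n = distrib A B C D (P n) (Q n)
    where
    distrib : ∀ A B C D x y → (A + C) * x + (B + D) * y ≡ (A * x + B * y) + (C * x + D * y)
    distrib = solve-∀

  ev-⊝ : ∀ F n → ev (⊝ F) n ≡ - ev F n
  ev-⊝ (A , B) n = negate A B (P n) (Q n)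
    where
    negate : ∀ A B x y → (- A) * x + (- B) * y ≡ - (A * x + B * y)
    negate = solve-∀

  ev-· : ∀ m F n → ev (m · F) n ≡ + m * ev F n
  ev-· m (A , B) n = scale (+ m) A B (P n) (Q n)
    where
    scale : ∀ m A B x y → (m * A) * x + (m * B) * y ≡ m * (A * x + B * y)
    scale = solve-∀

  ev-0⊖ : ∀ F n → ev (cst 0ℤ ⊖ F) n ≡ - ev F n
  ev-0⊖ (A , B) n = negate A B (P n) (Q n)
    where
    negate : ∀ A B x y → (0ℤ + - A) * x + (0ℤ + - B) * y ≡ - (A * x + B * y)
    negate = solve-∀

  ev-⊖0 : ∀ F n → ev (F ⊖ cst 0ℤ) n ≡ ev F n
  ev-⊖0 (A , B) n = drop A B (P n) (Q n)
    where
    drop : ∀ A B x y → (A + - 0ℤ) * x + (B + - 0ℤ) * y ≡ A * x + B * y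
    drop = solve-∀

  ev-2·⊖1 : ∀ F n → ev ((2 · F) ⊖ cst 1ℤ) n ≡ + 2 * ev F n - Q n
  ev-2·⊖1 (A , B) n = expand A B (P n) (Q n)
    where
    expand : ∀ A B x y → (+ 2 * A + - 0ℤ) * x + (+ 2 * B + - 1ℤ) * y ≡ + 2 * (A * x + B * y) - y
    expand = solve-∀

  ev-x⊖[x⊖y] : ∀ X Y n → ev (X ⊖ (X ⊖ Y)) n ≡ ev Y n
  ev-x⊖[x⊖y] (A , B) (C , D) n = cancel A B C D (P n) (Q n)
    where
    cancel : ∀ A B C D x y → (A + - (A + - C)) * x + (B + - (B + - D)) * y ≡ C * x + D * y
    cancel = solve-∀

  ev-x⊖[x⊖y⊖z] : ∀ X Y Z n → ev (X ⊖ (X ⊖ Y ⊖ Z)) n ≡ ev Y n + ev Z n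
  ev-x⊖[x⊖y⊖z] (A , B) (C , D) (E , F) n = cancel A B C D E F (P n) (Q n)
    where
    cancel : ∀ A B C D E F x y →
      (A + - (A + - C + - E)) * x + (B + - (B + - D + - F)) * y ≡ (C * x + D * y) + (E * x + F * y)
    cancel = solve-∀

  ev-[x⊕y⊕z]⊖x : ∀ X Y Z n → ev (X ⊕ Y ⊕ Z ⊖ X) n ≡ ev Y n + ev Z n
  ev-[x⊕y⊕z]⊖x (A , B) (C , D) (E , F) n = cancel A B C D E F (P n) (Q n)
    where
    cancel : ∀ A B C D E F x y →
      (A + C + E + - A) * x + (B + D + F + - B) * y ≡ (C * x + D * y) + (E * x + F * y)
    cancel = solve-∀

  ev-rec : ∀ F n → ev F (suc (suc n)) ≡ + a (suc (suc n)) * ev F (suc n) + ev F n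
  ev-rec (A , B) n = begin
    A * P (suc (suc n)) + B * Q (suc (suc n))
      ≡⟨ cong₂ (λ x y → A * x + B * y) (rec (p a (suc n)) (p a n)) (rec (q a (suc n)) (q a n)) ⟩
    A * (α * P (suc n) + P n) + B * (α * Q (suc n) + Q n)
      ≡⟨ collect α A B (P (suc n)) (P n) (Q (suc n)) (Q n) ⟩
    α * (A * P (suc n) + B * Q (suc n)) + (A * P n + B * Q n) ∎
    where
    open ≡-Reasoning
    α = + a (suc (suc n))
    rec : ∀ x y → + (a (suc (suc n)) ℕ.* x ℕ.+ y) ≡ α * + x + + y
    rec x y = trans (ℤP.pos-+ (a (suc (suc n)) ℕ.* x) y) (cong (_+ + y) (ℤP.pos-* (a (suc (suc n))) x))
    collect : ∀ α A B p₁ p₀ q₁ q₀ →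
      A * (α * p₁ + p₀) + B * (α * q₁ + q₀) ≡ α * (A * p₁ + B * q₁) + (A * p₀ + B * q₀)
    collect = solve-∀

  ev-+ₚ : ∀ u v n → ev (form (u +ₚ v)) n ≡ ev (form u) n + ev (form v) n
  ev-+ₚ (j , c) (j' , c') n = begin
    + (j ℕ.+ j') * P n + (c + c') * Q n  ≡⟨ cong (λ x → x * P n + (c + c') * Q n) (ℤP.pos-+ j j') ⟩
    (+ j + + j') * P n + (c + c') * Q n  ≡⟨ ev-⊕ (+ j , c) (+ j' , c') n ⟩
    ev (form (j , c)) n + ev (form (j' , c')) n ∎
    where open ≡-Reasoning

  convergent : ℕ → Point
  convergent m = q a m , - P m

  -- δ m and ‖δ‖ m are the sequences representing q_m θ - p_m and, for m ≥ 1, ‖q_m θ‖.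
  δ : ℕ → ℕ → ℤ
  δ m = ev (form (convergent m))

  δ-antisym : ∀ m n → δ m n ≡ - δ n m
  δ-antisym m n = antisym (Q m) (P m) (Q n) (P n)
    where
    antisym : ∀ qm pm qn pn → qm * pn + (- pm) * qn ≡ - (qn * pm + (- pn) * qm)
    antisym = solve-∀

  δ-diag : ∀ m → δ m m ≡ 0ℤ
  δ-diag m = cancel (Q m) (P m)
    where
    cancel : ∀ x y → x * y + (- y) * x ≡ 0ℤ
    cancel = solve-∀

  δ-rec : ∀ m n → δ (suc (suc m)) n ≡ + a (suc (suc m)) * δ (suc m) n + δ m n
  δ-rec m n = begin
    δ (suc (suc m)) n                            ≡⟨ δ-antisym (suc (suc m)) n ⟩
    - δ n (suc (suc m))                          ≡⟨ cong -_ (ev-rec (form (convergent n)) m) ⟩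
    - (α * δ n (suc m) + δ n m)                  ≡⟨ cong₂ (λ x y → - (α * x + y)) (δ-antisym n (suc m)) (δ-antisym n m) ⟩
    - (α * (- δ (suc m) n) + (- δ m n))          ≡⟨ negate α (δ (suc m) n) (δ m n) ⟩
    α * δ (suc m) n + δ m n ∎
    where
    open ≡-Reasoning
    α = + a (suc (suc m))
    negate : ∀ α x y → - (α * (- x) + (- y)) ≡ α * x + y
    negate = solve-∀

  δ-next : ∀ m → δ m (suc m) ≡ sgn m
  δ-next zero rewrite ℕP.*-zeroʳ (a 1) = refl
  δ-next (suc m) = begin
    δ (suc m) (suc (suc m))                        ≡⟨ ev-rec (form (convergent (suc m))) m ⟩
    α * δ (suc m) (suc m) + δ (suc m) m            ≡⟨ cong (λ x → α * x + δ (suc m) m) (δ-diag (suc m)) ⟩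
    α * 0ℤ + δ (suc m) m                           ≡⟨ cong (_+ δ (suc m) m) (ℤP.*-zeroʳ α) ⟩
    0ℤ + δ (suc m) m                               ≡⟨ ℤP.+-identityˡ (δ (suc m) m) ⟩
    δ (suc m) m                                    ≡⟨ δ-antisym (suc m) m ⟩
    - δ m (suc m)                                  ≡⟨ cong -_ (δ-next m) ⟩
    sgn (suc m) ∎
    where
    open ≡-Reasoning
    α = + a (suc (suc m))

  ‖δ‖ : ℕ → ℕ → ℤ
  ‖δ‖ m n = sgn m * δ m n

  δ≡sgn*‖δ‖ : ∀ m n → δ m n ≡ sgn m * ‖δ‖ m n
  δ≡sgn*‖δ‖ m n = begin
    δ m n                  ≡⟨ ℤP.*-identityˡ (δ m n) ⟨
    1ℤ * δ m n             ≡⟨ cong (_* δ m n) (sgn*sgn m) ⟨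
    sgn m * sgn m * δ m n  ≡⟨ ℤP.*-assoc (sgn m) (sgn m) (δ m n) ⟩
    sgn m * ‖δ‖ m n ∎
    where open ≡-Reasoning

  ‖δ‖-diag : ∀ m → ‖δ‖ m m ≡ 0ℤ
  ‖δ‖-diag m = trans (cong (sgn m *_) (δ-diag m)) (ℤP.*-zeroʳ (sgn m))

  ‖δ‖-next : ∀ m → ‖δ‖ m (suc m) ≡ 1ℤ
  ‖δ‖-next m = trans (cong (sgn m *_) (δ-next m)) (sgn*sgn m)

  sgn*δ[1+n]≡-‖δ‖[1+n] : ∀ n x → sgn n * δ (suc n) x ≡ - ‖δ‖ (suc n) x
  sgn*δ[1+n]≡-‖δ‖[1+n] n x = begin
    sgn n * δ (suc n) x                    ≡⟨ cong (sgn n *_) (δ≡sgn*‖δ‖ (suc n) x) ⟩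
    sgn n * (- sgn n * ‖δ‖ (suc n) x)      ≡⟨ regroup (sgn n) (‖δ‖ (suc n) x) ⟩
    - (sgn n * sgn n * ‖δ‖ (suc n) x)      ≡⟨ cong (λ s → - (s * ‖δ‖ (suc n) x)) (sgn*sgn n) ⟩
    - (1ℤ * ‖δ‖ (suc n) x)                 ≡⟨ cong -_ (ℤP.*-identityˡ _) ⟩
    - ‖δ‖ (suc n) x ∎
    where
    open ≡-Reasoning
    regroup : ∀ s g → s * (- s * g) ≡ - (s * s * g)
    regroup = solve-∀

  ‖δ‖-ev-rec : ∀ m n → ‖δ‖ m (suc (suc n)) ≡ + a (suc (suc n)) * ‖δ‖ m (suc n) + ‖δ‖ m n
  ‖δ‖-ev-rec m n = trans (cong (sgn m *_) (ev-rec (form (convergent m)) n))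
                      (distrib (sgn m) (+ a (suc (suc n))) (δ m (suc n)) (δ m n))
    where
    distrib : ∀ s α x y → s * (α * x + y) ≡ α * (s * x) + s * y
    distrib = solve-∀

  ‖δ‖-rec : ∀ m n → ‖δ‖ m n ≡ + a (suc (suc m)) * ‖δ‖ (suc m) n + ‖δ‖ (suc (suc m)) n
  ‖δ‖-rec m n = begin
    sgn m * δ m n
      ≡⟨ regroup (sgn m) α (δ (suc m) n) (δ m n) ⟩
    α * (- sgn m * δ (suc m) n) + (- - sgn m) * (α * δ (suc m) n + δ m n)
      ≡⟨ cong (λ x → α * ‖δ‖ (suc m) n + (- - sgn m) * x) (δ-rec m n) ⟨
    α * ‖δ‖ (suc m) n + ‖δ‖ (suc (suc m)) n ∎
    where
    open ≡-Reasoning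
    α = + a (suc (suc m))
    regroup : ∀ s α x y → s * y ≡ α * (- s * x) + (- - s) * (α * x + y)
    regroup = solve-∀

  -- In real terms: q_{m+1} ‖q_m θ‖ + q_m ‖q_{m+1} θ‖ = 1.
  Q-decomposition : ∀ m n → Q n ≡ Q (suc m) * ‖δ‖ m n + Q m * ‖δ‖ (suc m) n
  Q-decomposition m n = sym (begin
    Q (suc m) * ‖δ‖ m n + Q m * ‖δ‖ (suc m) n  ≡⟨ expand (sgn m) (Q m) (P m) (Q (suc m)) (P (suc m)) (Q n) (P n) ⟩
    sgn m * Q n * δ m (suc m)                  ≡⟨ cong (sgn m * Q n *_) (δ-next m) ⟩
    sgn m * Q n * sgn m                        ≡⟨ commute (sgn m) (Q n) ⟩
    Q n * (sgn m * sgn m)                      ≡⟨ cong (Q n *_) (sgn*sgn m) ⟩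
    Q n * 1ℤ                                   ≡⟨ ℤP.*-identityʳ (Q n) ⟩
    Q n ∎)
    where
    open ≡-Reasoning
    expand : ∀ s qm pm qm' pm' qn pn →
      qm' * (s * (qm * pn + (- pm) * qn)) + qm * (- s * (qm' * pn + (- pm') * qn)) ≡ s * qn * (qm * pm' + (- pm) * qm')
    expand = solve-∀
    commute : ∀ s x → s * x * s ≡ x * (s * s)
    commute = solve-∀

module Distances (a : CF) (a-pos : ∀ n → 1 ≤ a (suc n)) where

  open Convergents a
  open import Data.Integer using (_+_; _*_; _-_)

  q-pos : ∀ n → 1 ≤ q a n
  q-pos zero = s≤s z≤n
  q-pos (suc n) = ℕP.≤-trans (ℕP.*-mono-≤ (a-pos n) (q-pos n)) (ℕP.m≤m+n _ _)

  q≤a*q : ∀ n → q a n ≤ a (suc n) ℕ.* q a n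
  q≤a*q n = ℕP.m≤n*m (q a n) (a (suc n)) {{ℕ.>-nonZero (a-pos n)}}

  q-mono : ∀ n → q a n ≤ q a (suc n)
  q-mono n = ℕP.≤-trans (q≤a*q n) (ℕP.m≤m+n _ _)

  q≥2 : ∀ n → 2 ≤ q a (suc (suc n))
  q≥2 n = ℕP.+-mono-≤ (ℕP.≤-trans (q-pos (suc n)) (q≤a*q (suc n))) (q-pos n)

  ‖δ‖-bounds : ∀ m d → 0ℤ ℤ.≤ ‖δ‖ m (d ℕ.+ m) × 0ℤ ℤ.< ‖δ‖ m (suc d ℕ.+ m)
  ‖δ‖-bounds m zero =
    subst (0ℤ ℤ.≤_) (sym (‖δ‖-diag m)) ℤP.≤-refl , subst (0ℤ ℤ.<_) (sym (‖δ‖-next m)) (ℤ.+<+ (s≤s z≤n))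
  ‖δ‖-bounds m (suc d) with ‖δ‖-bounds m d
  ... | g₀≥0 , g₁>0 = ℤP.<⇒≤ g₁>0 , subst (0ℤ ℤ.<_) (sym (‖δ‖-ev-rec m (d ℕ.+ m)))
          (ℤP.+-mono-<-≤ (*-pos (ℤ.+<+ (a-pos (suc (d ℕ.+ m)))) g₁>0) g₀≥0)

  ‖δ‖-nonneg : ∀ {m n} → m ≤ n → 0ℤ ℤ.≤ ‖δ‖ m n
  ‖δ‖-nonneg {m} {n} m≤n =
    subst (λ n → 0ℤ ℤ.≤ ‖δ‖ m n) (ℕP.m∸n+n≡m m≤n) (proj₁ (‖δ‖-bounds m (n ℕ.∸ m)))

  ‖δ‖-pos : ∀ {m n} → m < n → 0ℤ ℤ.< ‖δ‖ m n
  ‖δ‖-pos {m} {suc n} (s≤s m≤n) =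
    subst (λ n → 0ℤ ℤ.< ‖δ‖ m (suc n)) (ℕP.m∸n+n≡m m≤n) (proj₂ (‖δ‖-bounds m (n ℕ.∸ m)))

  ‖δ‖≥ᵉ0 : ∀ m → ‖δ‖ m ≥ᵉ (λ _ → 0ℤ)
  ‖δ‖≥ᵉ0 m = m , λ _ → ‖δ‖-nonneg

  ‖δ‖-antitone : ∀ m → ‖δ‖ m ≥ᵉ ‖δ‖ (suc (suc m))
  ‖δ‖-antitone m = suc m , λ n m<n → begin
    ‖δ‖ (suc (suc m)) n                                          ≤⟨ x≤y+x (*-nonneg (0≤+ (a (suc (suc m)))) (‖δ‖-nonneg m<n)) ⟩
    + a (suc (suc m)) * ‖δ‖ (suc m) n + ‖δ‖ (suc (suc m)) n      ≡⟨ ‖δ‖-rec m n ⟨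
    ‖δ‖ m n ∎
    where open ℤP.≤-Reasoning

  ‖δ‖-split : ∀ m → a (suc (suc m)) ≡ 1 → ∀ n → ‖δ‖ m n ≡ ‖δ‖ (suc m) n + ‖δ‖ (suc (suc m)) n
  ‖δ‖-split m a≡1 n = begin
    ‖δ‖ m n                                                  ≡⟨ ‖δ‖-rec m n ⟩
    + a (suc (suc m)) * ‖δ‖ (suc m) n + ‖δ‖ (suc (suc m)) n  ≡⟨ cong (λ α → + α * g₁ + g₂) a≡1 ⟩
    1ℤ * ‖δ‖ (suc m) n + ‖δ‖ (suc (suc m)) n                 ≡⟨ cong (_+ g₂) (ℤP.*-identityˡ g₁) ⟩
    ‖δ‖ (suc m) n + ‖δ‖ (suc (suc m)) n ∎
    where
    open ≡-Reasoning
    g₁ = ‖δ‖ (suc m) n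
    g₂ = ‖δ‖ (suc (suc m)) n

  Q-2‖δ‖>0 : ∀ {m n} → 1 ≤ m → suc (suc m) ≤ n → 0ℤ ℤ.< Q n - + 2 * ‖δ‖ m n
  Q-2‖δ‖>0 {suc m} {n} _ 2+m≤n =
    subst (ℤ._< Q n - + 2 * g) (ℤP.+-inverseʳ (+ 2 * g)) (ℤP.+-monoˡ-< (- (+ 2 * g)) 2g<Q)
    where
    open ℤP.≤-Reasoning
    g = ‖δ‖ (suc m) n
    g≥0 : 0ℤ ℤ.≤ g
    g≥0 = ‖δ‖-nonneg (ℕP.m+n≤o⇒n≤o 2 2+m≤n)
    2g<Q : + 2 * g ℤ.< Q n
    2g<Q = begin-strict
      + 2 * g                                                ≡⟨ ℤP.+-identityʳ (+ 2 * g) ⟨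
      + 2 * g + 0ℤ
        <⟨ ℤP.+-monoʳ-< (+ 2 * g) (*-pos (ℤ.+<+ (q-pos (suc m))) (‖δ‖-pos 2+m≤n)) ⟩
      + 2 * g + Q (suc m) * ‖δ‖ (suc (suc m)) n
        ≤⟨ ℤP.+-monoˡ-≤ _ (ℤP.*-monoʳ-≤-nonNeg g {{ℤ.nonNegative g≥0}} (ℤ.+≤+ (q≥2 m))) ⟩
      Q (suc (suc m)) * g + Q (suc m) * ‖δ‖ (suc (suc m)) n  ≡⟨ Q-decomposition (suc m) n ⟨
      Q n ∎

  -- In real terms: σ ‖q_m θ‖ + u with σ = ±1 and u ∈ ℤ lies in [0, 1/2] only for σ = 1 and u = 0,
  -- because ‖q_m θ‖ < 1/2.
  gap-unique : ∀ {m} → 1 ≤ m → ∀ σ u (z : ℕ → ℤ) → σ ≡ 1ℤ ⊎ σ ≡ -1ℤ →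
    (∀ n → z n ≡ σ * ‖δ‖ m n + u * Q n) →
    ¬ Eventually (λ n → 0ℤ ℤ.< - z n) → ¬ Eventually (λ n → 0ℤ ℤ.< + 2 * z n - Q n) →
    z ≡ᵉ ‖δ‖ m
  gap-unique {m} _ σ (+ 0) z (inj₁ refl) z≡ _ _ = 0 , λ n _ → trans (z≡ n) (unit (‖δ‖ m n) (Q n))
    where
    unit : ∀ g x → 1ℤ * g + + 0 * x ≡ g
    unit = solve-∀
  gap-unique {m} _ σ (+ 0) z (inj₂ refl) z≡ z≥0 _ = ⊥-elim (z≥0 (suc m , λ n m<n →
    subst (0ℤ ℤ.<_) (sym (trans (cong -_ (z≡ n)) (negate (‖δ‖ m n) (Q n)))) (‖δ‖-pos m<n)))
    where
    negate : ∀ g x → - (-1ℤ * g + + 0 * x) ≡ g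
    negate = solve-∀
  gap-unique {m} m≥1 σ +[1+ u ] z σ≡±1 z≡ _ 2z≤Q = ⊥-elim (2z≤Q (suc (suc m) , λ n 2+m≤n →
    subst (0ℤ ℤ.<_) (sym (trans (cong (λ x → + 2 * x - Q n) (z≡ n)) (regroup σ (+ u) (‖δ‖ m n) (Q n))))
      (pos+nonneg+nonneg (Q-2‖δ‖>0 m≥1 2+m≤n)
        (ℤP.*-monoˡ-≤-nonNeg (+ 2) (proj₁ (sign-bounds σ≡±1 (‖δ‖-nonneg (ℕP.m+n≤o⇒n≤o 2 2+m≤n)))))
                           (*-nonneg (0≤+ 2) (*-nonneg (0≤+ u) (0≤+ (q a n)))))))
    where
    regroup : ∀ σ u g x → + 2 * (σ * g + (+ 1 + u) * x) - x ≡ (x - + 2 * g) + + 2 * (g + σ * g) + + 2 * (u * x)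
    regroup = solve-∀
  gap-unique {m} m≥1 σ -[1+ u ] z σ≡±1 z≡ z≥0 _ = ⊥-elim (z≥0 (suc (suc m) , λ n 2+m≤n →
    subst (0ℤ ℤ.<_) (sym (trans (cong -_ (z≡ n)) (regroup σ (+ u) (‖δ‖ m n) (Q n))))
      (pos+nonneg+nonneg (Q-2‖δ‖>0 m≥1 2+m≤n) (proj₂ (sign-bounds σ≡±1 (g≥0 2+m≤n)))
                           (ℤP.+-mono-≤ (g≥0 2+m≤n) (*-nonneg (0≤+ u) (0≤+ (q a n)))))))
    where
    g≥0 : ∀ {n} → suc (suc m) ≤ n → 0ℤ ℤ.≤ ‖δ‖ m n
    g≥0 2+m≤n = ‖δ‖-nonneg (ℕP.m+n≤o⇒n≤o 2 2+m≤n)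
    regroup : ∀ σ u g x → - (σ * g + (- (+ 1 + u)) * x) ≡ (x - + 2 * g) + (g - σ * g) + (g + u * x)
    regroup = solve-∀

  IsDist⇒≡ᵉ‖δ‖ : ∀ {m d} → 1 ≤ m → IsDist a (q a m) d → ev d ≡ᵉ ‖δ‖ m
  IsDist⇒≡ᵉ‖δ‖ {m} m≥1 (c , inj₁ (refl , y≥0) , 2y≤1) =
    gap-unique m≥1 (sgn m) (P m - c) (ev y) (sgn≡±1 m) y≡
      (λ -y>0 → y≥0 (eventually-map (λ {n} → subst (0ℤ ℤ.<_) (sym (ev-0⊖ y n))) -y>0))
      (λ 2y>1 → 2y≤1 (eventually-map (λ {n} → subst (0ℤ ℤ.<_) (sym (ev-2·⊖1 y n))) 2y>1))
    where
    y = θ-mul (q a m) (- c)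
    y≡ : ∀ n → ev y n ≡ sgn m * ‖δ‖ m n + (P m - c) * Q n
    y≡ n = trans (split (Q m) (P m) c (P n) (Q n)) (cong (_+ (P m - c) * Q n) (δ≡sgn*‖δ‖ m n))
      where
      split : ∀ qm pm c pn qn → qm * pn + (- c) * qn ≡ (qm * pn + (- pm) * qn) + (pm - c) * qn
      split = solve-∀
  IsDist⇒≡ᵉ‖δ‖ {m} m≥1 (c , inj₂ (refl , y≤0) , 2y≤1) =
    gap-unique m≥1 (sgn (suc m)) (c - P m) (ev (⊝ y)) (sgn≡±1 (suc m)) y≡
      (λ y>0 → y≤0 (eventually-map (λ {n} → subst (0ℤ ℤ.<_) (flip n)) y>0))
      (λ 2y>1 → 2y≤1 (eventually-map (λ {n} → subst (0ℤ ℤ.<_) (sym (ev-2·⊖1 (⊝ y) n))) 2y>1))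
    where
    y = θ-mul (q a m) (- c)
    flip : ∀ n → - ev (⊝ y) n ≡ ev (y ⊖ cst 0ℤ) n
    flip n = trans (cong -_ (ev-⊝ y n)) (trans (ℤP.neg-involutive (ev y n)) (sym (ev-⊖0 y n)))
    y≡ : ∀ n → ev (⊝ y) n ≡ - sgn m * ‖δ‖ m n + (c - P m) * Q n
    y≡ n = trans (split (Q m) (P m) c (P n) (Q n))
      (cong (_+ (c - P m) * Q n) (trans (cong -_ (δ≡sgn*‖δ‖ m n)) (ℤP.neg-distribˡ-* (sgn m) (‖δ‖ m n))))
      where
      split : ∀ qm pm c pn qn → (- qm) * pn + (- - c) * qn ≡ - (qm * pn + (- pm) * qn) + (c - pm) * qn
      split = solve-∀

  ≥ᵉ‖δ‖⇒>0 : ∀ m {f} → f ≥ᵉ ‖δ‖ m → Eventually (λ n → 0ℤ ℤ.< f n)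
  ≥ᵉ‖δ‖⇒>0 m f≥‖δ‖ =
    eventually-map (λ (‖δ‖≤f , ‖δ‖>0) → ℤP.<-≤-trans ‖δ‖>0 ‖δ‖≤f) (f≥‖δ‖ ∧ᵉ (suc m , λ _ → ‖δ‖-pos))

module Arcs (a : CF) (a-pos : ∀ n → 1 ≤ a (suc n)) (lo hi : Form) where

  open Convergents a
  open Distances a a-pos
  open import Data.Integer using (_+_; _*_; _-_)

  marginˡ marginʳ : Point → ℕ → ℤ
  marginˡ u = ev (form u ⊖ lo)
  marginʳ u = ev (hi ⊖ form u)

  marginˡ-move : ∀ u v x {e} → ev (form v) x ≡ ev (form u) x + e → marginˡ v x ≡ marginˡ u x + e
  marginˡ-move u v x {e} v≡u+e = begin
    ev (form v ⊖ lo) x                 ≡⟨ ev-⊕ (form v) (⊝ lo) x ⟩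
    ev (form v) x + ev (⊝ lo) x        ≡⟨ cong (_+ ev (⊝ lo) x) v≡u+e ⟩
    ev (form u) x + e + ev (⊝ lo) x    ≡⟨ swap-last (ev (form u) x) e (ev (⊝ lo) x) ⟩
    ev (form u) x + ev (⊝ lo) x + e    ≡⟨ cong (_+ e) (ev-⊕ (form u) (⊝ lo) x) ⟨
    ev (form u ⊖ lo) x + e ∎
    where
    open ≡-Reasoning
    swap-last : ∀ x y z → x + y + z ≡ x + z + y
    swap-last = solve-∀

  marginʳ-move : ∀ u v x {e} → ev (form v) x ≡ ev (form u) x + e → marginʳ v x ≡ marginʳ u x - e
  marginʳ-move u v x {e} v≡u+e = begin
    ev (hi ⊖ form v) x                 ≡⟨ ev-⊕ hi (⊝ form v) x ⟩
    ev hi x + ev (⊝ form v) x          ≡⟨ cong (λ y → ev hi x + y) (ev-⊝ (form v) x) ⟩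
    ev hi x - ev (form v) x            ≡⟨ cong (λ y → ev hi x - y) v≡u+e ⟩
    ev hi x - (ev (form u) x + e)      ≡⟨ regroup (ev hi x) (ev (form u) x) e ⟩
    ev hi x - ev (form u) x - e        ≡⟨ cong (λ y → ev hi x + y - e) (ev-⊝ (form u) x) ⟨
    ev hi x + ev (⊝ form u) x - e      ≡⟨ cong (_- e) (ev-⊕ hi (⊝ form u) x) ⟨
    ev (hi ⊖ form u) x - e ∎
    where
    open ≡-Reasoning
    regroup : ∀ x y z → x - (y + z) ≡ x - y - z
    regroup = solve-∀

  -- The distances from u to the ends of the arc behind and ahead of it, seen in the direction of
  -- q_n θ - p_n, whose sign is (-1)^n.
  trailing leading : ℕ → Point → ℕ → ℤ
  trailing zero = marginˡ
  trailing (suc n) = leading n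
  leading zero = marginʳ
  leading (suc n) = trailing n

  trailing-+ₚ : ∀ n u v x → trailing n (u +ₚ v) x ≡ trailing n u x + sgn n * ev (form v) x
  leading-+ₚ : ∀ n u v x → leading n (u +ₚ v) x ≡ leading n u x - sgn n * ev (form v) x
  trailing-+ₚ zero u v x =
    trans (marginˡ-move u (u +ₚ v) x (ev-+ₚ u v x)) (cong (λ y → marginˡ u x + y) (sym (ℤP.*-identityˡ _)))
  trailing-+ₚ (suc n) u v x = trans (leading-+ₚ n u v x) (cong (λ y → leading n u x + y) (ℤP.neg-distribˡ-* (sgn n) _))
  leading-+ₚ zero u v x =
    trans (marginʳ-move u (u +ₚ v) x (ev-+ₚ u v x)) (cong (λ e → marginʳ u x - e) (sym (ℤP.*-identityˡ _)))
  leading-+ₚ (suc n) u v x = trans (trailing-+ₚ n u v x) (flip (trailing n u x) (sgn n) (ev (form v) x))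
    where
    flip : ∀ t s e → t + s * e ≡ t - (- s) * e
    flip = solve-∀

  trailing-shift : ∀ n u x → trailing n (u +ₚ convergent (suc n)) x ≡ trailing n u x - ‖δ‖ (suc n) x
  trailing-shift n u x = trans (trailing-+ₚ n u (convergent (suc n)) x)
    (cong (λ y → trailing n u x + y) (sgn*δ[1+n]≡-‖δ‖[1+n] n x))

  leading-shift : ∀ n u x → leading n (u +ₚ convergent (suc n)) x ≡ leading n u x + ‖δ‖ (suc n) x
  leading-shift n u x = trans (leading-+ₚ n u (convergent (suc n)) x)
    (cong (λ y → leading n u x + y) (trans (cong -_ (sgn*δ[1+n]≡-‖δ‖[1+n] n x)) (ℤP.neg-involutive _)))

  record WellPlaced (n : ℕ) (u : Point) : Set where
    field
      index-pos : 1 ≤ proj₁ u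
      index-bound : proj₁ u ≤ q a n
      trailing-room : trailing n u ≥ᵉ ‖δ‖ n
      leading-room : leading n u ≥ᵉ ‖δ‖ (suc n)

  record Shiftable (n : ℕ) (u : Point) : Set where
    field
      index-pos : 1 ≤ proj₁ u
      index-bound : proj₁ u ℕ.+ q a (suc n) ≤ q a (suc (suc n))
      trailing-room : trailing n u ≥ᵉ (λ x → ‖δ‖ (suc n) x + ‖δ‖ (suc (suc n)) x)
      leading-room : leading n u ≥ᵉ ‖δ‖ (suc n)

  keep : ∀ {n u} → WellPlaced (suc n) u → WellPlaced (suc (suc n)) u
  keep {n} placed = record
    { index-pos = index-pos
    ; index-bound = ℕP.≤-trans index-bound (q-mono (suc n))
    ; trailing-room = leading-room
    ; leading-room = ≥ᵉ-trans trailing-room (‖δ‖-antitone (suc n))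
    }
    where open WellPlaced placed

  shift : ∀ {n u} → Shiftable n u → WellPlaced (suc (suc n)) (u +ₚ convergent (suc n))
  shift {n} {u} shiftable = record
    { index-pos = ℕP.≤-trans index-pos (ℕP.m≤m+n _ _)
    ; index-bound = index-bound
    ; trailing-room = eventually-map (λ {x} room → begin
        ‖δ‖ (suc (suc n)) x                             ≡⟨ cancel (‖δ‖ (suc n) x) (‖δ‖ (suc (suc n)) x) ⟩
        ‖δ‖ (suc n) x + ‖δ‖ (suc (suc n)) x - ‖δ‖ (suc n) x  ≤⟨ ℤP.+-monoˡ-≤ (- ‖δ‖ (suc n) x) room ⟩
        trailing n u x - ‖δ‖ (suc n) x                  ≡⟨ trailing-shift n u x ⟨
        trailing n (u +ₚ convergent (suc n)) x ∎) trailing-room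
    ; leading-room = eventually-map (λ {x} (room , g≥0 , g≥g') → begin
        ‖δ‖ (suc (suc (suc n))) x                      ≤⟨ g≥g' ⟩
        ‖δ‖ (suc n) x                                  ≤⟨ x≤y+x (ℤP.≤-trans g≥0 room) ⟩
        leading n u x + ‖δ‖ (suc n) x                  ≡⟨ leading-shift n u x ⟨
        leading n (u +ₚ convergent (suc n)) x ∎) (leading-room ∧ᵉ ‖δ‖≥ᵉ0 (suc n) ∧ᵉ ‖δ‖-antitone (suc n))
    }
    where
    open Shiftable shiftable
    open ℤP.≤-Reasoning
    cancel : ∀ g g' → g' ≡ g + g' - g
    cancel = solve-∀

  shiftable : ∀ {n u} → a (suc (suc n)) ≡ 1 → WellPlaced n u → Shiftable n u
  shiftable {n} {u} a≡1 placed = record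
    { index-pos = index-pos
    ; index-bound = subst (λ α → proj₁ u ℕ.+ q a (suc n) ≤ α ℕ.* q a (suc n) ℕ.+ q a n) (sym a≡1) (begin
        proj₁ u ℕ.+ q a (suc n)          ≡⟨ ℕP.+-comm (proj₁ u) (q a (suc n)) ⟩
        q a (suc n) ℕ.+ proj₁ u          ≤⟨ ℕP.+-monoʳ-≤ (q a (suc n)) index-bound ⟩
        q a (suc n) ℕ.+ q a n            ≡⟨ cong (ℕ._+ q a n) (ℕP.*-identityˡ (q a (suc n))) ⟨
        1 ℕ.* q a (suc n) ℕ.+ q a n ∎)
    ; trailing-room = eventually-map (λ {x} → subst (ℤ._≤ trailing n u x) (‖δ‖-split n a≡1 x)) trailing-room
    ; leading-room = leading-room
    }
    where
    open WellPlaced placed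
    open ℕP.≤-Reasoning

  extend : ∀ {n c₀ c₁} → Family (WellPlaced (suc n)) c₁ → Family (Shiftable n) c₀ →
    Family (WellPlaced (suc (suc n))) (c₁ ℕ.+ c₀)
  extend {n} F₁ F₀ = family-++ (family-map id id keep F₁)
    (family-map (_+ₚ convergent (suc n)) (λ {u} {v} → ℕP.+-cancelʳ-≡ (q a (suc n)) (proj₁ u) (proj₁ v)) shift F₀)
    (λ s t → ℕP.<⇒≢ (begin-strict
      proj₁ (point F₁ s)                      ≤⟨ WellPlaced.index-bound (good F₁ s) ⟩
      q a (suc n)                             <⟨ ℕP.m<n+m (q a (suc n)) (Shiftable.index-pos (good F₀ t)) ⟩
      proj₁ (point F₀ t) ℕ.+ q a (suc n) ∎))
    where open ℕP.≤-Reasoning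

  step : ∀ n {c₀ c₁} → a (suc (suc n)) ≡ 1 →
    Family (WellPlaced n) c₀ → Family (WellPlaced (suc n)) c₁ → Family (WellPlaced (suc (suc n))) (c₁ ℕ.+ c₀)
  step n a≡1 F₀ F₁ = extend F₁ (family-map id id (shiftable a≡1) F₀)

  fibonacci-family : ∀ (c : ℕ → ℕ) → (∀ j → c (suc (suc j)) ≡ c (suc j) ℕ.+ c j) →
    ∀ m ℓ → (∀ j → 2 ≤ j → j ≤ ℓ → a (m ℕ.+ j) ≡ 1) →
    Family (WellPlaced m) (c 0) → Family (WellPlaced (suc m)) (c 1) → Family (WellPlaced (m ℕ.+ ℓ)) (c ℓ)
  fibonacci-family c c-rec m ℓ ones F₀ F₁ =
    subst (λ n → Family (WellPlaced n) (c ℓ)) (ℕP.+-comm ℓ m) (family ℓ ℕP.≤-refl)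
    where
    family : ∀ j → j ≤ ℓ → Family (WellPlaced (j ℕ.+ m)) (c j)
    family zero _ = F₀
    family (suc zero) _ = F₁
    family (suc (suc j)) 2+j≤ℓ = subst (Family _) (sym (c-rec j))
      (step (j ℕ.+ m) (trans (cong a (ℕP.+-comm (suc (suc j)) m)) (ones (suc (suc j)) (s≤s (s≤s z≤n)) 2+j≤ℓ))
        (family j (ℕP.≤-trans (ℕP.n≤1+n j) (ℕP.<⇒≤ 2+j≤ℓ))) (family (suc j) (ℕP.<⇒≤ 2+j≤ℓ)))

  margins-positive : ∀ n m m' {u} → trailing n u ≥ᵉ ‖δ‖ m → leading n u ≥ᵉ ‖δ‖ m' →
    (lo <[ a ] form u) × (form u <[ a ] hi)
  margins-positive zero m m' room room' = ≥ᵉ‖δ‖⇒>0 m room , ≥ᵉ‖δ‖⇒>0 m' room'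
  margins-positive (suc n) m m' room room' = margins-positive n m' m room' room

  family⇒AtLeast : ∀ {n N} → Family (WellPlaced n) N → AtLeast N (q a n) (λ j → InArc a j lo hi)
  family⇒AtLeast {n} F = proj₁ ∘ point F , distinct F , λ t →
    let open WellPlaced (good F t) in
    index-pos , index-bound , proj₂ (point F t) , margins-positive n n (suc n) trailing-room leading-room

  even-orientation : ∀ {k} → 2 ∣ k → ∀ u → trailing k u ≡ marginˡ u × leading k u ≡ marginʳ u
  even-orientation (divides h refl) u = orientation h
    where
    orientation : ∀ h → trailing (h ℕ.* 2) u ≡ marginˡ u × leading (h ℕ.* 2) u ≡ marginʳ u
    orientation zero = refl , refl
    orientation (suc h) = orientation h

  module Fan (k i r : ℕ) (k-even : 2 ∣ k) (i-pos : 1 ≤ i) (i≤q : i ≤ q a k) (r<a : r < a (suc k))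
             (right-room : marginʳ (i , 0ℤ) ≥ᵉ (λ x → + r * ‖δ‖ k x + ‖δ‖ (suc k) x)) where

    fan : ℕ → Point
    fan m = m ℕ.* q a k ℕ.+ i , + m * - P k

    fan-family : ∀ {G : Point → Set} → (∀ m → m ≤ r → G (fan m)) → Family G (suc r)
    fan-family fan-good = record
      { point = fan ∘ toℕ
      ; distinct = λ {s} {t} eq → toℕ-injective
          (ℕP.*-cancelʳ-≡ (toℕ s) (toℕ t) (q a k) {{ℕ.>-nonZero (q-pos k)}} (ℕP.+-cancelʳ-≡ i _ _ eq))
      ; good = λ t → fan-good (toℕ t) (ℕP.≤-pred (toℕ<n t))
      }

    ev-fan : ∀ m x → ev (form (fan m)) x ≡ ev (form (fan 0)) x + + m * ‖δ‖ k x
    ev-fan m x = begin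
      + (m ℕ.* q a k ℕ.+ i) * P x + (+ m * - P k) * Q x
        ≡⟨ cong (λ j → j * P x + (+ m * - P k) * Q x) (trans (ℤP.pos-+ _ i) (cong (_+ + i) (ℤP.pos-* m (q a k)))) ⟩
      (+ m * Q k + + i) * P x + (+ m * - P k) * Q x
        ≡⟨ regroup (+ m) (Q k) (P k) (+ i) (P x) (Q x) ⟩
      (+ i * P x + 0ℤ * Q x) + + m * δ k x
        ≡⟨ cong (λ e → ev (form (fan 0)) x + + m * e) δₖ≡‖δ‖ₖ ⟩
      ev (form (fan 0)) x + + m * ‖δ‖ k x ∎
      where
      open ≡-Reasoning
      regroup : ∀ m qk pk i px qx →
        (m * qk + i) * px + (m * - pk) * qx ≡ (i * px + 0ℤ * qx) + m * (qk * px + (- pk) * qx)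
      regroup = solve-∀
      δₖ≡‖δ‖ₖ : δ k x ≡ ‖δ‖ k x
      δₖ≡‖δ‖ₖ = trans (δ≡sgn*‖δ‖ k x) (trans (cong (_* ‖δ‖ k x) (sgn-even k-even)) (ℤP.*-identityˡ _))

    fan-bound : ∀ {m} → m ≤ r → m ℕ.* q a k ℕ.+ i ≤ q a (suc k)
    fan-bound {m} m≤r = begin
      m ℕ.* q a k ℕ.+ i             ≤⟨ ℕP.+-monoʳ-≤ (m ℕ.* q a k) i≤q ⟩
      m ℕ.* q a k ℕ.+ q a k         ≡⟨ ℕP.+-comm (m ℕ.* q a k) (q a k) ⟩
      suc m ℕ.* q a k               ≤⟨ ℕP.*-monoˡ-≤ (q a k) (ℕP.≤-trans (s≤s m≤r) r<a) ⟩
      a (suc k) ℕ.* q a k           ≤⟨ ℕP.m≤m+n _ _ ⟩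
      q a (suc k) ∎
      where open ℕP.≤-Reasoning

    marginˡ-fan : ∀ {f} m → marginˡ (fan 0) ≥ᵉ f → marginˡ (fan m) ≥ᵉ f
    marginˡ-fan {f} m left-room = eventually-map (λ {x} (room , g≥0) → begin
      f x                                ≤⟨ room ⟩
      marginˡ (fan 0) x                  ≤⟨ x≤x+y (*-nonneg (0≤+ m) g≥0) ⟩
      marginˡ (fan 0) x + + m * ‖δ‖ k x  ≡⟨ marginˡ-move (fan 0) (fan m) x (ev-fan m x) ⟨
      marginˡ (fan m) x ∎) (left-room ∧ᵉ ‖δ‖≥ᵉ0 k)
      where open ℤP.≤-Reasoning

    marginʳ-fan : ∀ {m} → m ≤ r → marginʳ (fan m) ≥ᵉ ‖δ‖ (suc k)
    marginʳ-fan {m} m≤r = eventually-map (λ {x} (room , g≥0) → begin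
      ‖δ‖ (suc k) x                                    ≤⟨ x≤y+x (*-nonneg (0≤+ (r ℕ.∸ m)) g≥0) ⟩
      + (r ℕ.∸ m) * ‖δ‖ k x + ‖δ‖ (suc k) x            ≡⟨ split x ⟩
      + r * ‖δ‖ k x + ‖δ‖ (suc k) x - + m * ‖δ‖ k x    ≤⟨ ℤP.+-monoˡ-≤ (- (+ m * ‖δ‖ k x)) room ⟩
      marginʳ (fan 0) x - + m * ‖δ‖ k x                ≡⟨ marginʳ-move (fan 0) (fan m) x (ev-fan m x) ⟨
      marginʳ (fan m) x ∎) (right-room ∧ᵉ ‖δ‖≥ᵉ0 k)
      where
      open ℤP.≤-Reasoning
      cancel : ∀ m t g h → t * g + h ≡ (m + t) * g + h - m * g
      cancel = solve-∀
      split : ∀ x → + (r ℕ.∸ m) * ‖δ‖ k x + ‖δ‖ (suc k) x ≡ + r * ‖δ‖ k x + ‖δ‖ (suc k) x - + m * ‖δ‖ k x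
      split x = trans (cancel (+ m) (+ (r ℕ.∸ m)) (‖δ‖ k x) (‖δ‖ (suc k) x))
        (cong (λ s → s * ‖δ‖ k x + ‖δ‖ (suc k) x - + m * ‖δ‖ k x)
          (trans (sym (ℤP.pos-+ m (r ℕ.∸ m))) (cong +_ (ℕP.m+[n∸m]≡n m≤r))))

    centre-placed : marginˡ (fan 0) ≥ᵉ ‖δ‖ k → WellPlaced k (fan 0)
    centre-placed left-room = record
      { index-pos = i-pos
      ; index-bound = i≤q
      ; trailing-room = subst (_≥ᵉ ‖δ‖ k) (sym trailing≡) left-room
      ; leading-room = subst (_≥ᵉ ‖δ‖ (suc k)) (sym leading≡) (marginʳ-fan z≤n)
      }
      where
      trailing≡ = proj₁ (even-orientation k-even (fan 0))
      leading≡ = proj₂ (even-orientation k-even (fan 0))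

    fan-placed : marginˡ (fan 0) ≥ᵉ ‖δ‖ (suc (suc k)) → ∀ m → m ≤ r → WellPlaced (suc k) (fan m)
    fan-placed left-room m m≤r = record
      { index-pos = ℕP.≤-trans i-pos (ℕP.m≤n+m i _)
      ; index-bound = fan-bound m≤r
      ; trailing-room = subst (_≥ᵉ ‖δ‖ (suc k)) (sym leading≡) (marginʳ-fan m≤r)
      ; leading-room = subst (_≥ᵉ ‖δ‖ (suc (suc k))) (sym trailing≡) (marginˡ-fan m left-room)
      }
      where
      trailing≡ = proj₁ (even-orientation k-even (fan m))
      leading≡ = proj₂ (even-orientation k-even (fan m))

    fan-shiftable : a (suc (suc k)) ≡ 2 →
      marginˡ (fan 0) ≥ᵉ (λ x → ‖δ‖ (suc k) x + ‖δ‖ (suc (suc k)) x) → ∀ m → m ≤ r → Shiftable k (fan m)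
    fan-shiftable a≡2 left-room m m≤r = record
      { index-pos = ℕP.≤-trans i-pos (ℕP.m≤n+m i _)
      ; index-bound = subst (λ α → m ℕ.* q a k ℕ.+ i ℕ.+ q a (suc k) ≤ α ℕ.* q a (suc k) ℕ.+ q a k) (sym a≡2) (begin
          m ℕ.* q a k ℕ.+ i ℕ.+ q a (suc k)        ≤⟨ ℕP.+-monoˡ-≤ (q a (suc k)) (fan-bound m≤r) ⟩
          q a (suc k) ℕ.+ q a (suc k)              ≡⟨ cong (q a (suc k) ℕ.+_) (ℕP.+-identityʳ (q a (suc k))) ⟨
          2 ℕ.* q a (suc k)                        ≤⟨ ℕP.m≤m+n _ _ ⟩
          2 ℕ.* q a (suc k) ℕ.+ q a k ∎)
      ; trailing-room = subst (_≥ᵉ _) (sym trailing≡) (marginˡ-fan m left-room)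
      ; leading-room = subst (_≥ᵉ ‖δ‖ (suc k)) (sym leading≡) (marginʳ-fan m≤r)
      }
      where
      open ℕP.≤-Reasoning
      trailing≡ = proj₁ (even-orientation k-even (fan m))
      leading≡ = proj₂ (even-orientation k-even (fan m))

  arc-count-ones : ∀ k ℓ i r → 2 ∣ k → 1 ≤ i → i ≤ q a k → r < a (suc k) →
    (∀ j → 2 ≤ j → j ≤ ℓ → a (k ℕ.+ j) ≡ 1) →
    marginˡ (i , 0ℤ) ≥ᵉ ‖δ‖ k → marginʳ (i , 0ℤ) ≥ᵉ (λ x → + r * ‖δ‖ k x + ‖δ‖ (suc k) x) →
    AtLeast (fib ℓ ℕ.* r ℕ.+ fib (ℓ ℕ.+ 1)) (q a (k ℕ.+ ℓ)) (λ j → InArc a j lo hi)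
  arc-count-ones k ℓ i r k-even i-pos i≤q r<a ones left-room right-room =
    family⇒AtLeast (fibonacci-family count count-rec k ℓ ones (family-singleton (centre-placed left-room)) fan-level)
    where
    open Fan k i r k-even i-pos i≤q r<a right-room
    count : ℕ → ℕ
    count j = fib j ℕ.* r ℕ.+ fib (j ℕ.+ 1)
    count-rec : ∀ j → count (suc (suc j)) ≡ count (suc j) ℕ.+ count j
    count-rec j = regroup (fib (suc j)) (fib j) (fib (suc (j ℕ.+ 1))) (fib (j ℕ.+ 1)) r
      where
      regroup : ∀ f₁ f₀ g₁ g₀ r →
        (f₁ ℕ.+ f₀) ℕ.* r ℕ.+ (g₁ ℕ.+ g₀) ≡ (f₁ ℕ.* r ℕ.+ g₁) ℕ.+ (f₀ ℕ.* r ℕ.+ g₀)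
      regroup = ℕ-Solver.solve-∀
    fan-level : Family (WellPlaced (suc k)) (count 1)
    fan-level = subst (Family _) (trans (ℕP.+-comm 1 r) (cong (ℕ._+ 1) (sym (ℕP.*-identityˡ r))))
      (fan-family (fan-placed (≥ᵉ-trans left-room (‖δ‖-antitone k))))

  arc-count-two-ones : ∀ k ℓ i r → 2 ∣ k → 1 ≤ i → i ≤ q a k → r < a (suc k) →
    1 ≤ ℓ → a (suc (suc k)) ≡ 2 →
    (∀ j → 3 ≤ j → j ≤ ℓ → a (k ℕ.+ j) ≡ 1) →
    marginˡ (i , 0ℤ) ≥ᵉ (λ x → ‖δ‖ (suc k) x + ‖δ‖ (suc (suc k)) x) →
    marginʳ (i , 0ℤ) ≥ᵉ (λ x → + r * ‖δ‖ k x + ‖δ‖ (suc k) x) →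
    AtLeast (fib (ℓ ℕ.+ 1) ℕ.* (r ℕ.+ 1)) (q a (k ℕ.+ ℓ)) (λ j → InArc a j lo hi)
  arc-count-two-ones k (suc ℓ) i r k-even i-pos i≤q r<a _ a≡2 ones left-room right-room =
    subst (λ n → AtLeast (count ℓ) (q a n) (λ j → InArc a j lo hi)) (sym (ℕP.+-suc k ℓ))
      (family⇒AtLeast (fibonacci-family count count-rec (suc k) ℓ ones′ fan-level double-fan-level))
    where
    open Fan k i r k-even i-pos i≤q r<a right-room
    count : ℕ → ℕ
    count j = fib (suc j ℕ.+ 1) ℕ.* (r ℕ.+ 1)
    count-rec : ∀ j → count (suc (suc j)) ≡ count (suc j) ℕ.+ count j
    count-rec j = ℕP.*-distribʳ-+ (r ℕ.+ 1) (fib (suc (suc (j ℕ.+ 1)))) (fib (suc (j ℕ.+ 1)))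
    ones′ : ∀ j → 2 ≤ j → j ≤ ℓ → a (suc k ℕ.+ j) ≡ 1
    ones′ j 2≤j j≤ℓ = trans (cong a (sym (ℕP.+-suc k j))) (ones (suc j) (s≤s 2≤j) (s≤s j≤ℓ))
    fan-placed′ : ∀ m → m ≤ r → WellPlaced (suc k) (fan m)
    fan-placed′ = fan-placed (≥ᵉ-trans left-room (eventually-map x≤y+x (‖δ‖≥ᵉ0 (suc k))))
    fan-level : Family (WellPlaced (suc k)) (count 0)
    fan-level = subst (Family _) (trans (ℕP.+-comm 1 r) (sym (ℕP.*-identityˡ (r ℕ.+ 1)))) (fan-family fan-placed′)
    double-fan-level : Family (WellPlaced (suc (suc k))) (count 1)
    double-fan-level = subst (Family _) (double r)
      (extend (fan-family fan-placed′) (fan-family (fan-shiftable a≡2 left-room)))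
      where
      double : ∀ r → (1 ℕ.+ r) ℕ.+ (1 ℕ.+ r) ≡ 2 ℕ.* (r ℕ.+ 1)
      double = ℕ-Solver.solve-∀

isqrt²≤ : ∀ n → isqrt n ℕ.* isqrt n ≤ n
isqrt²≤ zero = z≤n
isqrt²≤ (suc n) with isqrt n | isqrt²≤ n
... | s | s²≤n with suc s ℕ.* suc s ℕ.≤ᵇ suc n in le
... | true = ℕP.≤ᵇ⇒≤ (suc s ℕ.* suc s) (suc n) (subst T (sym le) tt)
... | false = ℕP.≤-trans s²≤n (ℕP.n≤1+n n)

isqrt< : ∀ {n s} → n < s ℕ.* s → isqrt n < s
isqrt< {n} {s} n<s² =
  ℕP.≰⇒> (λ s≤isqrt → ℕP.<⇒≱ n<s² (ℕP.≤-trans (ℕP.*-mono-≤ s≤isqrt s≤isqrt) (isqrt²≤ n)))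

r<x : ∀ x → 1 ≤ x → r x < x
r<x 1 _ = s≤s z≤n
r<x 2 _ = s≤s (s≤s z≤n)
r<x (suc (suc (suc y))) _ = s≤s (ℕP.∸-monoˡ-≤ 3 (ℕP.≤-pred (isqrt< {s = 6 ℕ.+ y} bound)))
  where
  square : ∀ y → suc (4 ℕ.* (3 ℕ.+ y) ℕ.+ 5) ℕ.+ (18 ℕ.+ 8 ℕ.* y ℕ.+ y ℕ.* y) ≡ (6 ℕ.+ y) ℕ.* (6 ℕ.+ y)
  square = ℕ-Solver.solve-∀
  bound : 4 ℕ.* (3 ℕ.+ y) ℕ.+ 5 < (6 ℕ.+ y) ℕ.* (6 ℕ.+ y)
  bound = ℕP.≤-trans (ℕP.m≤m+n _ (18 ℕ.+ 8 ℕ.* y ℕ.+ y ℕ.* y)) (ℕP.≤-reflexive (square y))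

r̃<x : ∀ x y → 1 ≤ x → r̃ x y < x
r̃<x 1 _ h = r<x 1 h
r̃<x 2 _ h = r<x 2 h
r̃<x 3 _ h = r<x 3 h
r̃<x 4 0 h = r<x 4 h
r̃<x 4 1 h = r<x 4 h
r̃<x 4 (suc (suc _)) _ = s≤s (s≤s (s≤s z≤n))
r̃<x (suc (suc (suc (suc (suc x))))) _ h = r<x (5 ℕ.+ x) h

open import Data.Nat using (_+_)

lemma4p3 : (a : CF) → (∀ n → 1 ≤ a (n + 1)) →
    (k ℓ : ℕ) → 1 ≤ k → 2 ∣ k → 1 ≤ ℓ →
    (d₀ d₁ d₂ : Form) →
    IsDist a (q a k) d₀ → IsDist a (q a (k + 1)) d₁ → IsDist a (q a (k + 2)) d₂ →
    ((∀ j → 2 ≤ j → j ≤ ℓ → a (k + j) ≡ 1) →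
       ∀ i → 1 ≤ i → i ≤ q a k →
       AtLeast (fib ℓ Data.Nat.* r̃ (a (k + 1)) (a (k + 2)) + fib (ℓ + 1)) (q a (k + ℓ))
         (λ j → InArc a j (θ-mul i (+ 0) ⊖ d₀)
                          (θ-mul i (+ 0) ⊕ (r̃ (a (k + 1)) (a (k + 2)) · d₀) ⊕ d₁)))
    ×
    (a (k + 2) ≡ 2 → (∀ j → 3 ≤ j → j ≤ ℓ → a (k + j) ≡ 1) →
       ∀ i → 1 ≤ i → i ≤ q a k →
       AtLeast (fib (ℓ + 1) Data.Nat.* (r̃ (a (k + 1)) (a (k + 2)) + 1)) (q a (k + ℓ))
         (λ j → InArc a j (θ-mul i (+ 0) ⊖ d₁ ⊖ d₂)
                          (θ-mul i (+ 0) ⊕ (r̃ (a (k + 1)) (a (k + 2)) · d₀) ⊕ d₁)))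
lemma4p3 a a-pos k ℓ k≥1 k-even ℓ≥1 d₀ d₁ d₂ dist₀ dist₁ dist₂ =
  (λ ones i i-pos i≤q →
    Arcs.arc-count-ones a a-pos′ (centre i ⊖ d₀) (hi i)
      k ℓ i r̃ₖ₊₁ k-even i-pos i≤q r̃<a ones (left-room-ones i) (right-room i)) ,
  (λ a≡2 ones i i-pos i≤q →
    Arcs.arc-count-two-ones a a-pos′ (centre i ⊖ d₁ ⊖ d₂) (hi i)
      k ℓ i r̃ₖ₊₁ k-even i-pos i≤q r̃<a ℓ≥1 (trans (cong a (ℕP.+-comm 2 k)) a≡2) ones
      (left-room-two-ones i) (right-room i))
  where
  open Convergents a
  a-pos′ : ∀ n → 1 ≤ a (suc n)
  a-pos′ n = subst (λ m → 1 ≤ a m) (ℕP.+-comm n 1) (a-pos n)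
  open Distances a a-pos′
  r̃ₖ₊₁ : ℕ
  r̃ₖ₊₁ = r̃ (a (k + 1)) (a (k + 2))
  r̃<a : r̃ₖ₊₁ < a (suc k)
  r̃<a = subst (λ m → r̃ₖ₊₁ < a m) (ℕP.+-comm k 1) (r̃<x (a (k + 1)) (a (k + 2)) (a-pos k))
  ‖d₀‖ : ev d₀ ≡ᵉ ‖δ‖ k
  ‖d₀‖ = IsDist⇒≡ᵉ‖δ‖ k≥1 dist₀
  ‖d₁‖ : ev d₁ ≡ᵉ ‖δ‖ (suc k)
  ‖d₁‖ = IsDist⇒≡ᵉ‖δ‖ (s≤s z≤n) (subst (λ m → IsDist a (q a m) d₁) (ℕP.+-comm k 1) dist₁)
  ‖d₂‖ : ev d₂ ≡ᵉ ‖δ‖ (suc (suc k))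
  ‖d₂‖ = IsDist⇒≡ᵉ‖δ‖ (s≤s z≤n) (subst (λ m → IsDist a (q a m) d₂) (ℕP.+-comm k 2) dist₂)
  centre : ℕ → Form
  centre i = θ-mul i (+ 0)
  hi : ℕ → Form
  hi i = centre i ⊕ (r̃ₖ₊₁ · d₀) ⊕ d₁
  left-room-ones : ∀ i → ev (centre i ⊖ (centre i ⊖ d₀)) ≥ᵉ ‖δ‖ k
  left-room-ones i = ≡ᵉ⇒≥ᵉ (eventually-map (λ {x} → trans (ev-x⊖[x⊖y] (centre i) d₀ x)) ‖d₀‖)
  left-room-two-ones : ∀ i →
    ev (centre i ⊖ (centre i ⊖ d₁ ⊖ d₂)) ≥ᵉ (λ x → ‖δ‖ (suc k) x ℤ.+ ‖δ‖ (suc (suc k)) x)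
  left-room-two-ones i = ≡ᵉ⇒≥ᵉ (eventually-map (λ {x} (e₁ , e₂) →
    trans (ev-x⊖[x⊖y⊖z] (centre i) d₁ d₂ x) (cong₂ ℤ._+_ e₁ e₂)) (‖d₁‖ ∧ᵉ ‖d₂‖))
  right-room : ∀ i → ev (hi i ⊖ centre i) ≥ᵉ (λ x → + r̃ₖ₊₁ ℤ.* ‖δ‖ k x ℤ.+ ‖δ‖ (suc k) x)
  right-room i = ≡ᵉ⇒≥ᵉ (eventually-map (λ {x} (e₀ , e₁) →
    trans (ev-[x⊕y⊕z]⊖x (centre i) (r̃ₖ₊₁ · d₀) d₁ x)
      (cong₂ ℤ._+_ (trans (ev-· r̃ₖ₊₁ d₀ x) (cong (+ r̃ₖ₊₁ ℤ.*_) e₀)) e₁)) (‖d₀‖ ∧ᵉ ‖d₁‖))
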